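{- Let $\sigma$ be a position of the parallel chip-firing game on the complete bipartite graph $K_{a,b}$. If $p(\sigma)$ is odd, then $p(\sigma)\le\min(a,b)$; if $p(\sigma)$ is even, then $p(\sigma)\le 2\min(a,b)$.
   Context: Parallel chip-firing game: a position $\sigma$ assigns a nonnegative integer to each vertex; at each step every vertex $v$ with at least $\deg(v)$ chips simultaneously sends one chip to each neighbor. $U$ is the step operator. The period $p(\sigma)$ is the least positive integer $p$ with $U^t\sigma=U^{t+p}\sigma$ for all sufficiently large $t$. -}

module Defs where

open import Data.Nat using (ℕ; zero; suc; _+_; _*_; _∸_; _≤_; _<_; _≤ᵇ_; _<ᵇ_)
open import Data.Fin using (Fin; zero; suc; toℕ)
open import Data.Bool using (Bool; true; false; if_then_else_)
open import Data.Sum using (_⊎_; inj₁; inj₂)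
open import Data.Product using (_×_; ∃-syntax)
open import Relation.Nullary using (¬_)
open import Relation.Binary.PropositionalEquality using (_≡_)
open import Function using (_∘_)

sumFin : (n : ℕ) → (Fin n → ℕ) → ℕ
sumFin zero    f = 0
sumFin (suc n) f = f zero + sumFin n (f ∘ suc)

record Graph : Set where
  field
    size : ℕ
    adj  : Fin size → Fin size → Bool

open Graph public

Vertex : Graph → Set
Vertex G = Fin (size G)

indicator : Bool → ℕ
indicator true  = 1
indicator false = 0

deg : (G : Graph) → Vertex G → ℕ
deg G v = sumFin (size G) (λ u → indicator (adj G v u))

Position : Graph → Set
Position G = Vertex G → ℕ

fires : (G : Graph) → Position G → Vertex G → Bool
fires G σ v = deg G v ≤ᵇ σ v

U : (G : Graph) → Position G → Position G
U G σ v =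
  (σ v ∸ (if fires G σ v then deg G v else 0))
  + sumFin (size G) (λ u → indicator (adj G v u) * indicator (fires G σ u))

iterU : (G : Graph) → ℕ → Position G → Position G
iterU G zero    σ = σ
iterU G (suc t) σ = U G (iterU G t σ)

EventuallyPeriodic : (G : Graph) → Position G → ℕ → Set
EventuallyPeriodic G σ p =
  ∃[ T ] (∀ t → T ≤ t → ∀ v → iterU G t σ v ≡ iterU G (t + p) σ v)

IsPeriod : (G : Graph) → Position G → ℕ → Set
IsPeriod G σ p =
  (0 < p) × EventuallyPeriodic G σ p
  × (∀ q → 0 < q → q < p → ¬ EventuallyPeriodic G σ q)

-- Complete bipartite graph K_{a,b}: vertices 0..a-1 form one side,
-- a..a+b-1 the other; u ~ v iff they lie on different sides.
inLeft : (a b : ℕ) → Fin (a + b) → Bool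
inLeft a b v = toℕ v <ᵇ a

xorB : Bool → Bool → Bool
xorB true  true  = false
xorB true  false = true
xorB false true  = true
xorB false false = false

K : ℕ → ℕ → Graph
K a b = record
  { size = a + b
  ; adj  = λ u v → xorB (inLeft a b u) (inLeft a b v)
  }

module Submission where

-- The period divides every eventual period (Periods), so it suffices to find
-- an eventual period 2ℓ with 0 < ℓ ≤ min(a, b).  Fix the periodic regime.
-- If some vertex holds at least 2·deg chips there, it and its neighbours fire
-- throughout, so every vertex within distance two fires and the game is
-- stationary (Dynamics.Regime); in K a b this is every vertex.  Otherwise
-- each vertex has fired ⌊(start + received)/deg⌋ times (Dynamics.Totals); the
-- vertices of a side receive equal totals, and two steps act on the left
-- totals as a monotone f with f (z + b) = f z + b, a lift of a degree-one
-- circle map.  Pigeonhole on the smaller side gives an orbit closing after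
-- ℓ ≤ min(a, b) rounds, and uniqueness of the rotation number (CircleMap)
-- makes every orbit close after ℓ rounds: the game has period 2ℓ
-- (BipartiteGame).

open import Defs
open import Data.Nat using (ℕ; zero; suc; _+_; _*_; _∸_; _≤_; _<_; _≤ᵇ_; _<ᵇ_; _⊓_; z≤n; s≤s; z<s; NonZero; >-nonZero)
open import Data.Nat.Properties
open import Data.Nat.DivMod using (_/_; _%_; m≡m%n+[m/n]*n; m%n<n; +-distrib-/-∣ʳ; m*n/n≡m; /-monoˡ-≤; m<n⇒m/n≡0; m/n≡1+[m∸n]/n)
open import Data.Nat.Divisibility using (_∣_; divides; ∣-refl; ∣⇒≤; 0∣⇒≡0; ∣m∸n∣n⇒∣m)
open import Data.Nat.Coprimality using (Coprime; coprime-divisor)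
open import Data.Nat.Induction using (<-rec)
open import Data.Nat.GeneralisedArithmetic using (fold; fold-+)
open import Data.Nat.Tactic.RingSolver using (solve-∀)
open import Algebra.Properties.CommutativeSemigroup +-commutativeSemigroup using (interchange; xy∙z≈xz∙y)
open import Data.Fin as Fin using (Fin; toℕ)
open import Data.Fin.Properties using (pigeonhole; toℕ-fromℕ<; toℕ<n; any?)
open import Data.Bool using (Bool; true; false; not; T; if_then_else_)
open import Data.Product using (∃; _×_; _,_)
open import Data.Sum using (_⊎_; inj₁; inj₂)
open import Data.Empty using (⊥-elim)
open import Relation.Nullary using (¬_; yes; no)
open import Relation.Binary.Definitions using (tri<; tri≈; tri>)
open import Relation.Binary.PropositionalEquality
open import Function using (_∘_)

sumFin-cong : ∀ n {f g : Fin n → ℕ} → (∀ u → f u ≡ g u) → sumFin n f ≡ sumFin n g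
sumFin-cong zero    f≡g = refl
sumFin-cong (suc n) f≡g = cong₂ _+_ (f≡g Fin.zero) (sumFin-cong n (f≡g ∘ Fin.suc))

sumFin-zero : ∀ n → sumFin n (λ _ → 0) ≡ 0
sumFin-zero zero    = refl
sumFin-zero (suc n) = sumFin-zero n

sumFin-one : ∀ n → sumFin n (λ _ → 1) ≡ n
sumFin-one zero    = refl
sumFin-one (suc n) = cong suc (sumFin-one n)

sumFin-+ : ∀ n (f g : Fin n → ℕ) → sumFin n (λ u → f u + g u) ≡ sumFin n f + sumFin n g
sumFin-+ zero    f g = refl
sumFin-+ (suc n) f g =
  trans (cong (f Fin.zero + g Fin.zero +_) (sumFin-+ n (f ∘ Fin.suc) (g ∘ Fin.suc)))
        (interchange (f Fin.zero) (g Fin.zero) _ _)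

sumFin-mono : ∀ n {f g : Fin n → ℕ} → (∀ u → f u ≤ g u) → sumFin n f ≤ sumFin n g
sumFin-mono zero    f≤g = z≤n
sumFin-mono (suc n) f≤g = +-mono-≤ (f≤g Fin.zero) (sumFin-mono n (f≤g ∘ Fin.suc))

sumFin-≤-≡ : ∀ n {f g : Fin n → ℕ} → (∀ u → f u ≤ g u) → sumFin n f ≡ sumFin n g →
             ∀ u → f u ≡ g u
sumFin-≤-≡ (suc n) {f} {g} f≤g sums≡ u with m≤n⇒m<n∨m≡n (f≤g Fin.zero)
... | inj₁ head< = ⊥-elim (<-irrefl sums≡ (+-mono-<-≤ head< (sumFin-mono n (f≤g ∘ Fin.suc))))
... | inj₂ head≡ with u
...   | Fin.zero  = head≡
...   | Fin.suc u = sumFin-≤-≡ n (f≤g ∘ Fin.suc) tails≡ u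
  where tails≡ : sumFin n (f ∘ Fin.suc) ≡ sumFin n (g ∘ Fin.suc)
        tails≡ = +-cancelˡ-≡ (f Fin.zero) _ _ (trans sums≡ (cong (_+ _) (sym head≡)))

shift-multiple : ∀ (g : ℕ → ℕ) c d → (∀ z → g (z + c) ≡ g z + d) →
                 ∀ k z → g (z + k * c) ≡ g z + k * d
shift-multiple g c d shift zero    z = trans (cong g (+-identityʳ z)) (sym (+-identityʳ _))
shift-multiple g c d shift (suc k) z = begin
    g (z + (c + k * c))  ≡⟨ cong g (reassoc z c (k * c)) ⟩
    g (z + k * c + c)    ≡⟨ shift _ ⟩
    g (z + k * c) + d    ≡⟨ cong (_+ d) (shift-multiple g c d shift k z) ⟩
    g z + k * d + d      ≡⟨ sym (reassoc (g z) d (k * d)) ⟩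
    g z + (d + k * d)    ∎
  where open ≡-Reasoning
        reassoc : ∀ z c kc → z + (c + kc) ≡ z + kc + c
        reassoc = solve-∀

step-mono : ∀ (g : ℕ → ℕ) → (∀ j → g j ≤ g (suc j)) → ∀ {i j} → i ≤ j → g i ≤ g j
step-mono g up {i} {j} i≤j = subst (λ k → g i ≤ g k) (m∸n+n≡m i≤j) (go (j ∸ i))
  where go : ∀ e → g i ≤ g (e + i)
        go zero    = ≤-refl
        go (suc e) = ≤-trans (go e) (up (e + i))

downward : ∀ p (P : ℕ → Set) → P p → (∀ j → j < p → P (suc j) → P j) → ∀ j → j ≤ p → P j
downward p P top step j j≤p = go (p ∸ j) j (m+[n∸m]≡n j≤p)
  where
    go : ∀ d j → j + d ≡ p → P j
    go zero    j j+0≡p = subst P (trans (sym j+0≡p) (+-identityʳ j)) top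
    go (suc d) j j+d≡p =
      step j (subst (j <_) j+d≡p (m<m+n j z<s)) (go d (suc j) (trans (sym (+-suc j d)) j+d≡p))

≤ᵇ-true : ∀ {m n} → (m ≤ᵇ n) ≡ true → m ≤ n
≤ᵇ-true {m} {n} e = ≤ᵇ⇒≤ m n (subst T (sym e) _)

≤ᵇ-false : ∀ {m n} → (m ≤ᵇ n) ≡ false → n < m
≤ᵇ-false {m} {n} e = ≰⇒> (λ m≤n → subst T e (≤⇒≤ᵇ m≤n))

≤⇒≤ᵇ-true : ∀ {m n} → m ≤ n → (m ≤ᵇ n) ≡ true
≤⇒≤ᵇ-true {m} {n} m≤n with m ≤ᵇ n in e
... | true  = refl
... | false = ⊥-elim (<⇒≱ (≤ᵇ-false e) m≤n)

-- Floor division, made total (⌊ x / 0 ⌋ = 0) so that it can be applied to a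
-- vertex degree without carrying a NonZero instance.
⌊_/_⌋ : ℕ → ℕ → ℕ
⌊ x / zero  ⌋ = 0
⌊ x / suc d ⌋ = x / suc d

⌊/⌋-+* : ∀ d → 0 < d → ∀ x k → ⌊ x + k * d / d ⌋ ≡ ⌊ x / d ⌋ + k
⌊/⌋-+* (suc d) _ x k = trans (+-distrib-/-∣ʳ x (divides k refl)) (cong (x / suc d +_) (m*n/n≡m k (suc d)))

⌊/⌋-mono : ∀ d {x y} → x ≤ y → ⌊ x / d ⌋ ≤ ⌊ y / d ⌋
⌊/⌋-mono zero    x≤y = z≤n
⌊/⌋-mono (suc d) x≤y = /-monoˡ-≤ (suc d) x≤y

⌊/⌋-below-double : ∀ d → 0 < d → ∀ x → x < 2 * d → ⌊ x / d ⌋ ≡ indicator (d ≤ᵇ x)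
⌊/⌋-below-double (suc d) _ x x<2d with suc d ≤ᵇ x in e
... | false = m<n⇒m/n≡0 (≤ᵇ-false {suc d} {x} e)
... | true  = trans (m/n≡1+[m∸n]/n d≤x) (cong suc (m<n⇒m/n≡0 rest<d))
  where d≤x : suc d ≤ x
        d≤x = ≤ᵇ-true {suc d} {x} e
        rest<d : x ∸ suc d < suc d
        rest<d = +-cancelˡ-< (suc d) _ _
          (subst₂ _<_ (sym (m+[n∸m]≡n d≤x)) (cong (suc d +_) (+-identityʳ (suc d))) x<2d)

-- Lifts of degree-one circle maps: f is monotone and commutes with the
-- translation by c.  Any two closed orbits have the same rotation number,
-- and then each closed orbit closes up with the period and turns of any other.
module CircleMap (f : ℕ → ℕ) (c : ℕ) (c>0 : 0 < c)
  (f-mono : ∀ {x y} → x ≤ y → f x ≤ f y) (f-shift : ∀ x → f (x + c) ≡ f x + c) where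

  iter : ℕ → ℕ → ℕ
  iter i x = fold x f i

  iter-+ : ∀ i j x → iter (i + j) x ≡ iter i (iter j x)
  iter-+ i j x = fold-+ x f i

  iter-mono : ∀ i {x y} → x ≤ y → iter i x ≤ iter i y
  iter-mono zero    x≤y = x≤y
  iter-mono (suc i) x≤y = f-mono (iter-mono i x≤y)

  iter-shift : ∀ i x → iter i (x + c) ≡ iter i x + c
  iter-shift zero    x = refl
  iter-shift (suc i) x = trans (cong f (iter-shift i x)) (f-shift _)

  iter-shift* : ∀ i k x → iter i (x + k * c) ≡ iter i x + k * c
  iter-shift* i = shift-multiple (iter i) c c (iter-shift i)

  Closes : ℕ → ℕ → ℕ → Set
  Closes m k y = iter m y ≡ y + k * c

  closes-repeat : ∀ m k y → Closes m k y → ∀ r → Closes (r * m) (r * k) y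
  closes-repeat m k y closes zero    = sym (+-identityʳ y)
  closes-repeat m k y closes (suc r) = begin
      iter (m + r * m) y       ≡⟨ iter-+ m (r * m) y ⟩
      iter m (iter (r * m) y)  ≡⟨ cong (iter m) (closes-repeat m k y closes r) ⟩
      iter m (y + r * k * c)   ≡⟨ iter-shift* m (r * k) y ⟩
      iter m y + r * k * c     ≡⟨ cong (_+ r * k * c) closes ⟩
      y + k * c + r * k * c    ≡⟨ distrib y k (r * k) c ⟩
      y + (k + r * k) * c      ∎
    where open ≡-Reasoning
          distrib : ∀ y k rk c → y + k * c + rk * c ≡ y + (k + rk) * c
          distrib = solve-∀

  closes-shift : ∀ m k x → Closes m k x → ∀ q → Closes m k (x + q * c)
  closes-shift m k x closes q =
    trans (iter-shift* m q x) (trans (cong (_+ q * c) closes) (xy∙z≈xz∙y x (k * c) (q * c)))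

  private
    instance
      c≢0 : NonZero c
      c≢0 = >-nonZero c>0

    double-gap : ∀ A B → A * (2 * c) ≤ B * (2 * c) + c → A ≤ B
    double-gap A B gap = ≮⇒≥ λ B<A → <⇒≱ c>0 (+-cancelˡ-≤ c c 0
      (+-cancelʳ-≤ (B * (2 * c)) (c + c) (c + 0)
        (subst₂ _≤_ (lhs B c) (rhs B c) (≤-trans (*-monoˡ-≤ (2 * c) B<A) gap))))
      where lhs : ∀ B c → suc B * (2 * c) ≡ c + c + B * (2 * c)
            lhs = solve-∀
            rhs : ∀ B c → B * (2 * c) + c ≡ c + 0 + B * (2 * c)
            rhs = solve-∀

    closes-doubled : ∀ m k y → Closes m k y → ∀ r → iter (r * 2 * m) y ≡ y + (r * k) * (2 * c)
    closes-doubled m k y closes r =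
      trans (closes-repeat m k y closes (r * 2)) (cong (y +_) (regroup r k c))
      where regroup : ∀ r k c → r * 2 * k * c ≡ r * k * (2 * c)
            regroup = solve-∀

    window : ∀ x y → x ≤ y → ∃ λ q → x + q * c ≤ y × y ≤ x + q * c + c
    window x y x≤y = q , lower , upper
      where
        q r : ℕ
        q = (y ∸ x) / c
        r = (y ∸ x) % c
        y≡ : y ≡ x + (r + q * c)
        y≡ = trans (sym (m+[n∸m]≡n x≤y)) (cong (x +_) (m≡m%n+[m/n]*n (y ∸ x) c))
        lower : x + q * c ≤ y
        lower = subst (x + q * c ≤_) (sym y≡) (+-monoʳ-≤ x (m≤n+m (q * c) r))
        upper : y ≤ x + q * c + c
        upper = subst (_≤ x + q * c + c) (sym (trans y≡ (reorder x r (q * c))))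
                  (+-monoʳ-≤ (x + q * c) (<⇒≤ (m%n<n (y ∸ x) c)))
          where reorder : ∀ x r qc → x + (r + qc) ≡ x + qc + r
                reorder = solve-∀

    rotation-in-window : ∀ ℓ m k k' x y → x ≤ y → y ≤ x + c →
                         Closes ℓ k x → Closes m k' y → m * k ≡ ℓ * k'
    rotation-in-window ℓ m k k' x y x≤y y≤x+c closes-x closes-y =
      ≤-antisym (double-gap A B lower) (double-gap B A upper)
      where
        open ≤-Reasoning
        N A B w : ℕ
        N = m * 2 * ℓ
        A = m * k
        B = ℓ * k'
        w = 2 * c
        orbit-x : iter N x ≡ x + A * w
        orbit-x = closes-doubled ℓ k x closes-x m
        orbit-y : iter N y ≡ y + B * w
        orbit-y = trans (cong (λ i → iter i y) (swap m ℓ)) (closes-doubled m k' y closes-y ℓ)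
          where swap : ∀ m ℓ → m * 2 * ℓ ≡ ℓ * 2 * m
                swap = solve-∀
        lower : A * w ≤ B * w + c
        lower = +-cancelˡ-≤ x _ _ (begin
            x + A * w       ≡⟨ orbit-x ⟨
            iter N x        ≤⟨ iter-mono N x≤y ⟩
            iter N y        ≡⟨ orbit-y ⟩
            y + B * w       ≤⟨ +-monoˡ-≤ (B * w) y≤x+c ⟩
            x + c + B * w   ≡⟨ reorder x c (B * w) ⟩
            x + (B * w + c) ∎)
          where reorder : ∀ x c Bw → x + c + Bw ≡ x + (Bw + c)
                reorder = solve-∀
        upper : B * w ≤ A * w + c
        upper = +-cancelˡ-≤ x _ _ (begin
            x + B * w       ≤⟨ +-monoˡ-≤ (B * w) x≤y ⟩
            y + B * w       ≡⟨ orbit-y ⟨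
            iter N y        ≤⟨ iter-mono N y≤x+c ⟩
            iter N (x + c)  ≡⟨ iter-shift N x ⟩
            iter N x + c    ≡⟨ cong (_+ c) orbit-x ⟩
            x + A * w + c   ≡⟨ +-assoc x (A * w) c ⟩
            x + (A * w + c) ∎)

  rotation-unique : ∀ ℓ m k k' x y → Closes ℓ k x → Closes m k' y → m * k ≡ ℓ * k'
  rotation-unique ℓ m k k' x y closes-x closes-y with ≤-total x y
  ... | inj₁ x≤y = let q , lower , upper = window x y x≤y in
        rotation-in-window ℓ m k k' (x + q * c) y lower upper (closes-shift ℓ k x closes-x q) closes-y
  ... | inj₂ y≤x = let q , lower , upper = window y x y≤x in
        sym (rotation-in-window m ℓ k' k (y + q * c) x lower upper (closes-shift m k' y closes-y q) closes-x)

  private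
    drift-ahead : ∀ ℓ k y → y + k * c < iter ℓ y → ∀ r → y + (suc r * k) * c < iter (suc r * ℓ) y
    drift-ahead ℓ k y ahead zero =
      subst₂ (λ u v → y + u * c < iter v y) (sym (+-identityʳ k)) (sym (+-identityʳ ℓ)) ahead
    drift-ahead ℓ k y ahead (suc r) = begin-strict
        y + (k + suc r * k) * c      ≡⟨ distrib y k (suc r * k) c ⟩
        y + k * c + suc r * k * c    <⟨ +-monoˡ-< _ ahead ⟩
        iter ℓ y + suc r * k * c     ≡⟨ iter-shift* ℓ (suc r * k) y ⟨
        iter ℓ (y + suc r * k * c)   ≤⟨ iter-mono ℓ (<⇒≤ (drift-ahead ℓ k y ahead r)) ⟩
        iter ℓ (iter (suc r * ℓ) y)  ≡⟨ iter-+ ℓ (suc r * ℓ) y ⟨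
        iter (suc (suc r) * ℓ) y     ∎
      where open ≤-Reasoning
            distrib : ∀ y k rk c → y + (k + rk) * c ≡ y + k * c + rk * c
            distrib = solve-∀

    drift-behind : ∀ ℓ k y → iter ℓ y < y + k * c → ∀ r → iter (suc r * ℓ) y < y + (suc r * k) * c
    drift-behind ℓ k y behind zero =
      subst₂ (λ u v → iter v y < y + u * c) (sym (+-identityʳ k)) (sym (+-identityʳ ℓ)) behind
    drift-behind ℓ k y behind (suc r) = begin-strict
        iter (suc (suc r) * ℓ) y     ≡⟨ iter-+ ℓ (suc r * ℓ) y ⟩
        iter ℓ (iter (suc r * ℓ) y)  ≤⟨ iter-mono ℓ (<⇒≤ (drift-behind ℓ k y behind r)) ⟩
        iter ℓ (y + suc r * k * c)   ≡⟨ iter-shift* ℓ (suc r * k) y ⟩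
        iter ℓ y + suc r * k * c     <⟨ +-monoˡ-< _ behind ⟩
        y + k * c + suc r * k * c    ≡⟨ distrib y k (suc r * k) c ⟨
        y + (k + suc r * k) * c      ∎
      where open ≤-Reasoning
            distrib : ∀ y k rk c → y + (k + rk) * c ≡ y + k * c + rk * c
            distrib = solve-∀

    closes-after-m : ∀ ℓ m k k' x y → Closes ℓ k x → Closes m k' y → Closes (m * ℓ) (m * k) y
    closes-after-m ℓ m k k' x y closes-x closes-y = begin
        iter (m * ℓ) y   ≡⟨ cong (λ i → iter i y) (*-comm m ℓ) ⟩
        iter (ℓ * m) y   ≡⟨ closes-repeat m k' y closes-y ℓ ⟩
        y + ℓ * k' * c   ≡⟨ cong (λ t → y + t * c) (rotation-unique ℓ m k k' x y closes-x closes-y) ⟨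
        y + m * k * c    ∎
      where open ≡-Reasoning

  orbit-closes : ∀ ℓ m k k' x y → 0 < m → Closes ℓ k x → Closes m k' y → Closes ℓ k y
  orbit-closes ℓ (suc m) k k' x y _ closes-x closes-y with <-cmp (iter ℓ y) (y + k * c)
  ... | tri≈ _ closes _  = closes
  ... | tri< behind _ _ = ⊥-elim (<-irrefl around (drift-behind ℓ k y behind m))
    where around : Closes (suc m * ℓ) (suc m * k) y
          around = closes-after-m ℓ (suc m) k k' x y closes-x closes-y
  ... | tri> _ _ ahead  = ⊥-elim (<-irrefl (sym around) (drift-ahead ℓ k y ahead m))
    where around : Closes (suc m * ℓ) (suc m * k) y
          around = closes-after-m ℓ (suc m) k k' x y closes-x closes-y

-- Pigeonhole: among the c + 1 values z 0, …, z c of a monotone sequence two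
-- are congruent mod c, giving a shift z (ℓ + i) ≡ z i + k·c with 0 < ℓ ≤ c.
recurrence-mod : ∀ c → 0 < c → (z : ℕ → ℕ) → (∀ {i j} → i ≤ j → z i ≤ z j) →
                 ∃ λ i → ∃ λ ℓ → ∃ λ k → 0 < ℓ × ℓ ≤ c × z (ℓ + i) ≡ z i + k * c
recurrence-mod (suc c) _ z z-mono
  with i , j , i<j , same-residue ← pigeonhole (n<1+n (suc c)) (λ i → Fin.fromℕ< (m%n<n (z (toℕ i)) (suc c)))
  = iₙ , jₙ ∸ iₙ , k , m<n⇒0<n∸m i<j , ≤-trans (m∸n≤m jₙ iₙ) (≤-pred (toℕ<n j)) , shifted
  where
    C iₙ jₙ k : ℕ
    C = suc c
    iₙ = toℕ i
    jₙ = toℕ j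
    same-residueₙ : z iₙ % C ≡ z jₙ % C
    same-residueₙ = trans (sym (toℕ-fromℕ< (m%n<n (z iₙ) C)))
                      (trans (cong toℕ same-residue) (toℕ-fromℕ< (m%n<n (z jₙ) C)))
    quotients : z iₙ / C ≤ z jₙ / C
    quotients = /-monoˡ-≤ C (z-mono (<⇒≤ i<j))
    k = z jₙ / C ∸ z iₙ / C
    shifted : z (jₙ ∸ iₙ + iₙ) ≡ z iₙ + k * C
    shifted = begin
        z (jₙ ∸ iₙ + iₙ)
          ≡⟨ cong z (m∸n+n≡m (<⇒≤ i<j)) ⟩
        z jₙ
          ≡⟨ m≡m%n+[m/n]*n (z jₙ) C ⟩
        z jₙ % C + z jₙ / C * C
          ≡⟨ cong₂ (λ r q → r + q * C) same-residueₙ (m+[n∸m]≡n quotients) ⟨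
        z iₙ % C + (z iₙ / C + k) * C
          ≡⟨ regroup (z iₙ % C) (z iₙ / C) k C ⟩
        (z iₙ % C + z iₙ / C * C) + k * C
          ≡⟨ cong (_+ k * C) (m≡m%n+[m/n]*n (z iₙ) C) ⟨
        z iₙ + k * C ∎
      where open ≡-Reasoning
            regroup : ∀ r q k c → r + (q + k) * c ≡ (r + q * c) + k * c
            regroup = solve-∀

odd⇒coprime-2 : ∀ p → ¬ (2 ∣ p) → Coprime p 2
odd⇒coprime-2 p odd {i} (i∣p , i∣2) with i
... | 0 = ⊥-elim (1+n≢0 (0∣⇒≡0 i∣2))
... | 1 = refl
... | 2 = ⊥-elim (odd i∣p)
... | suc (suc (suc _)) = ⊥-elim (<⇒≱ (s≤s (s≤s (s≤s z≤n))) (∣⇒≤ i∣2))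

-- The numerical heart of the corollary: if p divides 2ℓ with ℓ ≤ m, then an
-- odd p divides ℓ (being coprime to 2), so p ≤ m, while in any case p ≤ 2m.
divisor-of-double-bound : ∀ p ℓ m → 0 < ℓ → ℓ ≤ m → p ∣ 2 * ℓ →
                          ((¬ (2 ∣ p)) → p ≤ m) × ((2 ∣ p) → p ≤ 2 * m)
divisor-of-double-bound p ℓ m ℓ>0 ℓ≤m p∣2ℓ = odd-case , even-case
  where
    instance
      ℓ≢0 : NonZero ℓ
      ℓ≢0 = >-nonZero ℓ>0
      2ℓ≢0 : NonZero (2 * ℓ)
      2ℓ≢0 = >-nonZero (≤-trans ℓ>0 (m≤m+n ℓ _))
    odd-case : ¬ (2 ∣ p) → p ≤ m
    odd-case odd = ≤-trans (∣⇒≤ (coprime-divisor (odd⇒coprime-2 p odd) p∣2ℓ)) ℓ≤m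
    even-case : 2 ∣ p → p ≤ 2 * m
    even-case _ = ≤-trans (∣⇒≤ p∣2ℓ) (*-monoʳ-≤ 2 ℓ≤m)

-- Eventual periods of a fixed position of a fixed graph: they are closed
-- under differences, so the least one (the period) divides all others.
module Periods (G : Graph) (σ : Position G) where

  EventuallyPeriodic-∸ : ∀ {N q} → q < N → EventuallyPeriodic G σ N → EventuallyPeriodic G σ q →
                         EventuallyPeriodic G σ (N ∸ q)
  EventuallyPeriodic-∸ {N} {q} q<N (T₁ , periodic-N) (T₂ , periodic-q) =
    T₁ + T₂ , λ t T₁+T₂≤t v → begin
      iterU G t σ v
        ≡⟨ periodic-N t (≤-trans (m≤m+n T₁ T₂) T₁+T₂≤t) v ⟩
      iterU G (t + N) σ v
        ≡⟨ cong (λ s → iterU G s σ v) (split t) ⟩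
      iterU G (t + (N ∸ q) + q) σ v
        ≡⟨ periodic-q (t + (N ∸ q)) (≤-trans (≤-trans (m≤n+m T₂ T₁) T₁+T₂≤t) (m≤m+n t _)) v ⟨
      iterU G (t + (N ∸ q)) σ v ∎
    where
      open ≡-Reasoning
      split : ∀ t → t + N ≡ t + (N ∸ q) + q
      split t = trans (cong (t +_) (sym (m∸n+n≡m (<⇒≤ q<N)))) (sym (+-assoc t (N ∸ q) q))

  -- The period divides every eventual period N, by strong induction on N: an
  -- N below p contradicts minimality, and for N > p, N ∸ p is again an eventual period.
  period-divides : ∀ {p} → IsPeriod G σ p → ∀ N → 0 < N → EventuallyPeriodic G σ N → p ∣ N
  period-divides {p} (p>0 , periodic , minimal) = <-rec _ divides-N
    where
      divides-N : ∀ N → (∀ {M} → M < N → 0 < M → EventuallyPeriodic G σ M → p ∣ M) →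
                  0 < N → EventuallyPeriodic G σ N → p ∣ N
      divides-N N smaller N>0 periodic-N with <-cmp N p
      ... | tri< N<p _ _ = ⊥-elim (minimal N N>0 N<p periodic-N)
      ... | tri≈ _ refl _ = ∣-refl
      ... | tri> _ _ p<N = ∣m∸n∣n⇒∣m p (<⇒≤ p<N)
              (smaller (∸-monoʳ-< p>0 (<⇒≤ p<N)) (m<n⇒0<n∸m p<N)
                (EventuallyPeriodic-∸ p<N periodic-N periodic)) ∣-refl

indicator≤1 : ∀ b → indicator b ≤ 1
indicator≤1 true  = ≤-refl
indicator≤1 false = z≤n

indicator≡1 : ∀ b → indicator b ≡ 1 → b ≡ true
indicator≡1 true _ = refl

-- The bookkeeping identity behind one parallel step at a vertex with x chips,
-- threshold d and i incoming chips: adding back the d chips sent when firing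
-- recovers x + i.
fire-identity : ∀ x d i → (x ∸ (if d ≤ᵇ x then d else 0)) + i + d * indicator (d ≤ᵇ x) ≡ x + i
fire-identity x d i with d ≤ᵇ x in fires
... | false = trans (cong (x + i +_) (*-zeroʳ d)) (+-identityʳ _)
... | true  = begin
    x ∸ d + i + d * 1  ≡⟨ cong (x ∸ d + i +_) (*-identityʳ d) ⟩
    x ∸ d + i + d      ≡⟨ xy∙z≈xz∙y (x ∸ d) i d ⟩
    x ∸ d + d + i      ≡⟨ cong (_+ i) (m∸n+n≡m (≤ᵇ-true {d} {x} fires)) ⟩
    x + i              ∎
  where open ≡-Reasoning

WithinTwo : (G : Graph) → Vertex G → Vertex G → Set
WithinTwo G v z = adj G v z ≡ true ⊎ ∃ λ u → adj G v u ≡ true × adj G u z ≡ true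

SameNeighbours : (G : Graph) → Vertex G → Vertex G → Set
SameNeighbours G v v' = ∀ u → adj G v u ≡ adj G v' u

module Dynamics (G : Graph) (σ : Position G) where

  n : ℕ
  n = size G

  chips : ℕ → Position G
  chips t = iterU G t σ

  degree : Vertex G → ℕ
  degree = deg G

  edge : Vertex G → Vertex G → ℕ
  edge v u = indicator (adj G v u)

  fired : ℕ → Vertex G → ℕ
  fired t u = indicator (fires G (chips t) u)

  received : ℕ → Vertex G → ℕ
  received t v = sumFin n (λ u → edge v u * fired t u)

  conservation : ∀ t v → chips (suc t) v + degree v * fired t v ≡ chips t v + received t v
  conservation t v = fire-identity (chips t v) (degree v) (received t v)

  received-term≤edge : ∀ t v u → edge v u * fired t u ≤ edge v u
  received-term≤edge t v u =
    subst (edge v u * fired t u ≤_) (*-identityʳ (edge v u)) (*-monoʳ-≤ (edge v u) (indicator≤1 _))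

  received≤degree : ∀ t v → received t v ≤ degree v
  received≤degree t v = sumFin-mono n (received-term≤edge t v)

  full⇒neighbour-fires : ∀ t w → received t w ≡ degree w → ∀ u → adj G w u ≡ true → fires G (chips t) u ≡ true
  full⇒neighbour-fires t w full u w~u = indicator≡1 _ (begin
      fired t u             ≡⟨ *-identityˡ (fired t u) ⟨
      1 * fired t u         ≡⟨ cong (λ b → indicator b * fired t u) w~u ⟨
      edge w u * fired t u  ≡⟨ sumFin-≤-≡ n (received-term≤edge t w) full u ⟩
      edge w u              ≡⟨ cong indicator w~u ⟩
      1                     ∎)
    where open ≡-Reasoning

  firing-step : ∀ t w → fires G (chips t) w ≡ true → chips (suc t) w + degree w ≡ chips t w + received t w
  firing-step t w fires-w = begin
      chips (suc t) w + degree w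
        ≡⟨ cong (chips (suc t) w +_) (*-identityʳ (degree w)) ⟨
      chips (suc t) w + degree w * 1
        ≡⟨ cong (λ b → chips (suc t) w + degree w * indicator b) fires-w ⟨
      chips (suc t) w + degree w * fired t w
        ≡⟨ conservation t w ⟩
      chips t w + received t w ∎
    where open ≡-Reasoning

  idle-step : ∀ t w → fires G (chips t) w ≡ false → chips (suc t) w ≡ chips t w + received t w
  idle-step t w idle = begin
      chips (suc t) w                         ≡⟨ +-identityʳ _ ⟨
      chips (suc t) w + 0                     ≡⟨ cong (chips (suc t) w +_) (*-zeroʳ (degree w)) ⟨
      chips (suc t) w + degree w * 0          ≡⟨ cong (λ b → chips (suc t) w + degree w * indicator b) idle ⟨
      chips (suc t) w + degree w * fired t w  ≡⟨ conservation t w ⟩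
      chips t w + received t w                ∎
    where open ≡-Reasoning

  same-neighbours⇒same-received : ∀ {v v'} → SameNeighbours G v v' → ∀ t → received t v ≡ received t v'
  same-neighbours⇒same-received same t = sumFin-cong n (λ u → cong (λ b → indicator b * fired t u) (same u))

  firing-nonincreasing : ∀ t w → fires G (chips t) w ≡ true → chips (suc t) w ≤ chips t w
  firing-nonincreasing t w fires-w = +-cancelʳ-≤ (degree w) _ _
    (subst (_≤ chips t w + degree w) (sym (firing-step t w fires-w)) (+-monoʳ-≤ (chips t w) (received≤degree t w)))

  firing-kept⇒full : ∀ t w → fires G (chips t) w ≡ true → chips t w ≤ chips (suc t) w → received t w ≡ degree w
  firing-kept⇒full t w fires-w kept = ≤-antisym (received≤degree t w) (+-cancelˡ-≤ (chips (suc t) w) _ _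
    (≤-trans (≤-reflexive (firing-step t w fires-w)) (+-monoˡ-≤ (received t w) kept)))

  -- A vertex with at least 2·deg chips fires, and had already fired at the previous step
  -- (an idle vertex holds fewer than deg chips and receives at most deg).
  rich⇒fires : ∀ t w → 2 * degree w ≤ chips t w → fires G (chips t) w ≡ true
  rich⇒fires t w rich = ≤⇒≤ᵇ-true (≤-trans (m≤m+n (degree w) _) rich)

  rich⇒fired-before : ∀ t w → 2 * degree w ≤ chips (suc t) w → fires G (chips t) w ≡ true
  rich⇒fired-before t w rich = by-cases (fires G (chips t) w) refl
    where
      open ≤-Reasoning
      by-cases : ∀ b → fires G (chips t) w ≡ b → fires G (chips t) w ≡ true
      by-cases true  fires-w = fires-w
      by-cases false idle    = ⊥-elim (<⇒≱ (begin-strict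
          chips (suc t) w           ≡⟨ idle-step t w idle ⟩
          chips t w + received t w  <⟨ +-mono-<-≤ (≤ᵇ-false {degree w} idle) (received≤degree t w) ⟩
          degree w + degree w       ≡⟨ cong (degree w +_) (+-identityʳ (degree w)) ⟨
          2 * degree w              ∎) rich)

  U-cong : ∀ {σ₁ σ₂ : Position G} → (∀ v → σ₁ v ≡ σ₂ v) → ∀ v → U G σ₁ v ≡ U G σ₂ v
  U-cong σ₁≡σ₂ v =
    cong₂ _+_ (cong₂ (λ x b → x ∸ (if b then deg G v else 0)) (σ₁≡σ₂ v) (cong (deg G v ≤ᵇ_) (σ₁≡σ₂ v)))
              (sumFin-cong n (λ u → cong (λ y → edge v u * indicator (deg G u ≤ᵇ y)) (σ₁≡σ₂ u)))

  -- If every vertex fires, every vertex receives its full degree and nothing changes.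
  all-fire⇒stationary : ∀ t → (∀ z → fires G (chips t) z ≡ true) → ∀ z → chips (suc t) z ≡ chips t z
  all-fire⇒stationary t all-fire z =
    +-cancelʳ-≡ (degree z) _ _ (trans (firing-step t z (all-fire z)) (cong (chips t z +_) full))
    where full : received t z ≡ degree z
          full = sumFin-cong n (λ u → trans (cong (λ b → edge z u * indicator b) (all-fire u)) (*-identityʳ (edge z u)))

  stationary⇒periodic : ∀ t₀ → (∀ z → chips (suc t₀) z ≡ chips t₀ z) → ∀ N → EventuallyPeriodic G σ N
  stationary⇒periodic t₀ fixed N =
    t₀ , λ t t₀≤t z → trans (constant t t₀≤t z) (sym (constant (t + N) (≤-trans t₀≤t (m≤m+n t N)) z))
    where
      constant-after : ∀ e z → chips (e + t₀) z ≡ chips t₀ z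
      constant-after zero    z = refl
      constant-after (suc e) z = trans (U-cong (constant-after e) z) (fixed z)
      constant : ∀ t → t₀ ≤ t → ∀ z → chips t z ≡ chips t₀ z
      constant t t₀≤t z = trans (cong (λ s → chips s z) (sym (m∸n+n≡m t₀≤t))) (constant-after (t ∸ t₀) z)

  module Regime (p : ℕ) (p>0 : 0 < p) (T : ℕ)
    (periodic : ∀ t → T ≤ t → ∀ v → chips t v ≡ chips (t + p) v) where

    periodic-multiple : ∀ q r v → chips (q * p + r + T) v ≡ chips (r + T) v
    periodic-multiple zero    r v = refl
    periodic-multiple (suc q) r v = begin
        chips (p + q * p + r + T) v    ≡⟨ cong (λ s → chips s v) (reorder p (q * p) r T) ⟩
        chips (q * p + r + T + p) v    ≡⟨ periodic (q * p + r + T) (m≤n+m T _) v ⟨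
        chips (q * p + r + T) v        ≡⟨ periodic-multiple q r v ⟩
        chips (r + T) v                ∎
      where open ≡-Reasoning
            reorder : ∀ p qp r T → p + qp + r + T ≡ qp + r + T + p
            reorder = solve-∀

    -- A vertex firing at every step of a period starting at t ≥ T never gains
    -- chips during it, yet returns to its count at t; so it kept its chips at
    -- step t and received its full degree.
    always-fires⇒full : ∀ t w → T ≤ t → (∀ j → j < p → fires G (chips (t + j)) w ≡ true) →
                        received t w ≡ degree w
    always-fires⇒full t w T≤t always = firing-kept⇒full t w fires-at-t kept
      where
        never-above-end : ∀ j → j ≤ p → chips (t + p) w ≤ chips (t + j) w
        never-above-end = downward p (λ j → chips (t + p) w ≤ chips (t + j) w) ≤-refl λ j j<p later →
          ≤-trans later (subst (λ s → chips s w ≤ chips (t + j) w) (sym (+-suc t j))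
                          (firing-nonincreasing (t + j) w (always j j<p)))
        fires-at-t : fires G (chips t) w ≡ true
        fires-at-t = subst (λ s → fires G (chips s) w ≡ true) (+-identityʳ t) (always 0 p>0)
        kept : chips t w ≤ chips (suc t) w
        kept = subst₂ (λ x s → x ≤ chips s w) (sym (periodic t T≤t w)) (+-comm t 1) (never-above-end 1 p>0)

    -- A vertex with at least 2·deg chips at t ≥ T keeps that many during the
    -- following period: going backwards from t + p, where it is rich again by
    -- periodicity, each step was a firing one and so lost no chips.
    rich-persists : ∀ t v → T ≤ t → 2 * degree v ≤ chips t v → ∀ j → j ≤ p → 2 * degree v ≤ chips (t + j) v
    rich-persists t v T≤t rich j j≤p =
      ≤-trans rich-at-end (downward p (λ j → chips (t + p) v ≤ chips (t + j) v) ≤-refl step j j≤p)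
      where
        rich-at-end : 2 * degree v ≤ chips (t + p) v
        rich-at-end = subst (2 * degree v ≤_) (periodic t T≤t v) rich
        step : ∀ j → j < p → chips (t + p) v ≤ chips (t + suc j) v → chips (t + p) v ≤ chips (t + j) v
        step j _ later = ≤-trans later′
          (firing-nonincreasing (t + j) v (rich⇒fired-before (t + j) v (≤-trans rich-at-end later′)))
          where later′ : chips (t + p) v ≤ chips (suc (t + j)) v
                later′ = subst (λ s → chips (t + p) v ≤ chips s v) (+-suc t j) later

    rich⇒full : ∀ t v → T ≤ t → 2 * degree v ≤ chips t v → received t v ≡ degree v
    rich⇒full t v T≤t rich = always-fires⇒full t v T≤t λ j j<p →
      rich⇒fires (t + j) v (rich-persists t v T≤t rich j (<⇒≤ j<p))

    -- All neighbours of a rich vertex fire throughout the period, so they receive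
    -- their full degree, and hence every vertex within distance two fires.
    rich⇒near-fires : ∀ t v → T ≤ t → 2 * degree v ≤ chips t v →
                      ∀ z → WithinTwo G v z → fires G (chips t) z ≡ true
    rich⇒near-fires t v T≤t rich z (inj₁ v~z) = full⇒neighbour-fires t v (rich⇒full t v T≤t rich) z v~z
    rich⇒near-fires t v T≤t rich z (inj₂ (u , v~u , u~z)) = full⇒neighbour-fires t u u-full z u~z
      where
        u-full : received t u ≡ degree u
        u-full = always-fires⇒full t u T≤t λ j j<p →
          full⇒neighbour-fires (t + j) v
            (rich⇒full (t + j) v (≤-trans T≤t (m≤m+n t j)) (rich-persists t v T≤t rich j (<⇒≤ j<p))) u v~u

    rich⇒constant : ∀ t v → T ≤ t → 2 * degree v ≤ chips t v → (∀ z → WithinTwo G v z) →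
                    ∀ N → EventuallyPeriodic G σ N
    rich⇒constant t v T≤t rich near =
      stationary⇒periodic t (all-fire⇒stationary t (λ z → rich⇒near-fires t v T≤t rich z (near z)))

  -- Cumulative counts over the steps T₀, T₀ + 1, …, T₀ + j - 1.
  module Totals (T₀ : ℕ) where

    start : Position G
    start = chips T₀

    received-total : ℕ → Vertex G → ℕ
    received-total zero    v = 0
    received-total (suc j) v = received-total j v + received (j + T₀) v

    fired-total : ℕ → Vertex G → ℕ
    fired-total zero    v = 0
    fired-total (suc j) v = fired-total j v + fired (j + T₀) v

    balance : ∀ j v → chips (j + T₀) v + degree v * fired-total j v ≡ start v + received-total j v
    balance zero    v = cong (start v +_) (*-zeroʳ (degree v))
    balance (suc j) v = begin
        chips (suc j + T₀) v + degree v * (fired-total j v + fired (j + T₀) v)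
          ≡⟨ distrib (chips (suc j + T₀) v) (degree v) _ _ ⟩
        (chips (suc (j + T₀)) v + degree v * fired (j + T₀) v) + degree v * fired-total j v
          ≡⟨ cong (_+ degree v * fired-total j v) (conservation (j + T₀) v) ⟩
        (chips (j + T₀) v + received (j + T₀) v) + degree v * fired-total j v
          ≡⟨ xy∙z≈xz∙y (chips (j + T₀) v) _ _ ⟩
        (chips (j + T₀) v + degree v * fired-total j v) + received (j + T₀) v
          ≡⟨ cong (_+ received (j + T₀) v) (balance j v) ⟩
        start v + received-total j v + received (j + T₀) v
          ≡⟨ +-assoc (start v) _ _ ⟩
        start v + received-total (suc j) v ∎
      where open ≡-Reasoning
            distrib : ∀ x d N f → x + d * (N + f) ≡ (x + d * f) + d * N
            distrib = solve-∀

    received-total≡ : ∀ j v → received-total j v ≡ sumFin n (λ u → edge v u * fired-total j u)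
    received-total≡ zero    v = sym (trans (sumFin-cong n (λ u → *-zeroʳ (edge v u))) (sumFin-zero n))
    received-total≡ (suc j) v = begin
        received-total j v + received (j + T₀) v
          ≡⟨ cong (_+ received (j + T₀) v) (received-total≡ j v) ⟩
        sumFin n (λ u → edge v u * fired-total j u) + received (j + T₀) v
          ≡⟨ sumFin-+ n _ _ ⟨
        sumFin n (λ u → edge v u * fired-total j u + edge v u * fired (j + T₀) u)
          ≡⟨ sumFin-cong n (λ u → *-distribˡ-+ (edge v u) (fired-total j u) _) ⟨
        sumFin n (λ u → edge v u * fired-total (suc j) u) ∎
      where open ≡-Reasoning

    fired-total-formula : ∀ j v → 0 < degree v → chips (j + T₀) v < 2 * degree v →
                          fired-total (suc j) v ≡ ⌊ start v + received-total j v / degree v ⌋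
    fired-total-formula j v degree>0 moderate = sym (begin
        ⌊ start v + received-total j v / degree v ⌋
          ≡⟨ cong (λ x → ⌊ x / degree v ⌋) (balance j v) ⟨
        ⌊ chips (j + T₀) v + degree v * fired-total j v / degree v ⌋
          ≡⟨ cong (λ x → ⌊ chips (j + T₀) v + x / degree v ⌋) (*-comm (degree v) _) ⟩
        ⌊ chips (j + T₀) v + fired-total j v * degree v / degree v ⌋
          ≡⟨ ⌊/⌋-+* (degree v) degree>0 _ _ ⟩
        ⌊ chips (j + T₀) v / degree v ⌋ + fired-total j v
          ≡⟨ cong (_+ fired-total j v) (⌊/⌋-below-double (degree v) degree>0 _ moderate) ⟩
        fired (j + T₀) v + fired-total j v
          ≡⟨ +-comm _ (fired-total j v) ⟩
        fired-total (suc j) v ∎)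
      where open ≡-Reasoning

    received-total-mono : ∀ v {i j} → i ≤ j → received-total i v ≤ received-total j v
    received-total-mono v = step-mono (λ j → received-total j v) (λ j → m≤m+n _ _)

    fired-total-mono : ∀ v {i j} → i ≤ j → fired-total i v ≤ fired-total j v
    fired-total-mono v = step-mono (λ j → fired-total j v) (λ j → m≤m+n _ _)

    same-chips⇒received : ∀ {i j} v → i ≤ j → chips (j + T₀) v ≡ chips (i + T₀) v →
                          received-total j v ≡ received-total i v + (fired-total j v ∸ fired-total i v) * degree v
    same-chips⇒received {i} {j} v i≤j same = +-cancelˡ-≡ (start v) _ _ (begin
        start v + received-total j v
          ≡⟨ balance j v ⟨
        chips (j + T₀) v + degree v * fired-total j v
          ≡⟨ cong₂ (λ x f → x + degree v * f) (sym same) (m+[n∸m]≡n (fired-total-mono v i≤j)) ⟨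
        chips (i + T₀) v + degree v * (fired-total i v + D)
          ≡⟨ distrib (chips (i + T₀) v) (degree v) (fired-total i v) D ⟩
        chips (i + T₀) v + degree v * fired-total i v + D * degree v
          ≡⟨ cong (_+ D * degree v) (balance i v) ⟩
        start v + received-total i v + D * degree v
          ≡⟨ +-assoc (start v) _ _ ⟩
        start v + (received-total i v + D * degree v) ∎)
      where open ≡-Reasoning
            D : ℕ
            D = fired-total j v ∸ fired-total i v
            distrib : ∀ x d f D → x + d * (f + D) ≡ x + d * f + D * d
            distrib = solve-∀

    received-fired⇒same-chips : ∀ {i j} v k → received-total j v ≡ received-total i v + k * degree v →
                                fired-total j v ≡ fired-total i v + k → chips (j + T₀) v ≡ chips (i + T₀) v
    received-fired⇒same-chips {i} {j} v k received-more fired-more =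
      +-cancelʳ-≡ (degree v * fired-total j v) _ _ (begin
        chips (j + T₀) v + degree v * fired-total j v
          ≡⟨ balance j v ⟩
        start v + received-total j v
          ≡⟨ cong (start v +_) received-more ⟩
        start v + (received-total i v + k * degree v)
          ≡⟨ +-assoc (start v) _ _ ⟨
        start v + received-total i v + k * degree v
          ≡⟨ cong (_+ k * degree v) (balance i v) ⟨
        chips (i + T₀) v + degree v * fired-total i v + k * degree v
          ≡⟨ distrib (chips (i + T₀) v) (degree v) (fired-total i v) k ⟩
        chips (i + T₀) v + degree v * (fired-total i v + k)
          ≡⟨ cong (λ f → chips (i + T₀) v + degree v * f) fired-more ⟨
        chips (i + T₀) v + degree v * fired-total j v ∎)
      where open ≡-Reasoning
            distrib : ∀ x d f k → x + d * f + k * d ≡ x + d * (f + k)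
            distrib = solve-∀

    same-neighbours⇒same-received-total : ∀ {v v'} → SameNeighbours G v v' →
                                          ∀ j → received-total j v ≡ received-total j v'
    same-neighbours⇒same-received-total same zero    = refl
    same-neighbours⇒same-received-total same (suc j) =
      cong₂ _+_ (same-neighbours⇒same-received-total same j) (same-neighbours⇒same-received same (j + T₀))

    -- The response of v to neighbours that have each received z chips in total:
    -- the number of chips v receives in total one step later.
    response : Vertex G → ℕ → ℕ
    response v z = sumFin n (λ u → edge v u * ⌊ start u + z / degree u ⌋)

    Moderate : Set
    Moderate = ∀ j u → chips (j + T₀) u < 2 * degree u

    response-step : (∀ u → 0 < degree u) → Moderate → ∀ j v w →
                    (∀ u → adj G v u ≡ true → received-total j u ≡ received-total j w) →
                    received-total (suc j) v ≡ response v (received-total j w)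
    response-step degree>0 moderate j v w same-totals =
      trans (received-total≡ (suc j) v) (sumFin-cong n λ u → edge-guarded (adj G v u) λ v~u →
        trans (fired-total-formula j u (degree>0 u) (moderate j u))
              (cong (λ z → ⌊ start u + z / degree u ⌋) (same-totals u v~u)))
      where edge-guarded : ∀ b {x y} → (b ≡ true → x ≡ y) → indicator b * x ≡ indicator b * y
            edge-guarded true  x≡y = cong (1 *_) (x≡y refl)
            edge-guarded false _   = refl

    response-mono : ∀ v {z z'} → z ≤ z' → response v z ≤ response v z'
    response-mono v z≤z' = sumFin-mono n λ u →
      *-monoʳ-≤ (edge v u) (⌊/⌋-mono (degree u) (+-monoʳ-≤ (start u) z≤z'))

    -- If all neighbours of v have degree c, then c more chips received by each
    -- neighbour make each of them fire once more, so v receives deg v more.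
    response-shift : ∀ v c → 0 < c → (∀ u → adj G v u ≡ true → degree u ≡ c) →
                     ∀ z → response v (z + c) ≡ response v z + degree v
    response-shift v c c>0 neighbour-degree z = trans (sumFin-cong n term-shift) (sumFin-+ n _ _)
      where
        term-shift : ∀ u → edge v u * ⌊ start u + (z + c) / degree u ⌋
                         ≡ edge v u * ⌊ start u + z / degree u ⌋ + edge v u
        term-shift u with adj G v u in v~u
        ... | false = refl
        ... | true  = begin
            1 * ⌊ start u + (z + c) / degree u ⌋
              ≡⟨ *-identityˡ _ ⟩
            ⌊ start u + (z + c) / degree u ⌋
              ≡⟨ cong₂ ⌊_/_⌋ (reassoc (start u) z c) (neighbour-degree u v~u) ⟩
            ⌊ start u + z + 1 * c / c ⌋
              ≡⟨ ⌊/⌋-+* c c>0 _ 1 ⟩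
            ⌊ start u + z / c ⌋ + 1
              ≡⟨ cong (λ d → ⌊ start u + z / d ⌋ + 1) (neighbour-degree u v~u) ⟨
            ⌊ start u + z / degree u ⌋ + 1
              ≡⟨ cong (_+ 1) (*-identityˡ _) ⟨
            1 * ⌊ start u + z / degree u ⌋ + 1 ∎
          where open ≡-Reasoning
                reassoc : ∀ x z c → x + (z + c) ≡ x + z + 1 * c
                reassoc = solve-∀

left-count : ∀ a b → sumFin (a + b) (λ u → indicator (toℕ u <ᵇ a)) ≡ a
left-count zero    b = sumFin-zero b
left-count (suc a) b = cong suc (left-count a b)

right-count : ∀ a b → sumFin (a + b) (λ u → indicator (not (toℕ u <ᵇ a))) ≡ b
right-count zero    b = sumFin-one b
right-count (suc a) b = right-count a b

module Bipartite (a b : ℕ) (a≥1 : 1 ≤ a) (b≥1 : 1 ≤ b) where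

  side : Vertex (K a b) → Bool
  side = inLeft a b

  side-degree : Bool → ℕ
  side-degree true  = b
  side-degree false = a

  degree-side : ∀ v → deg (K a b) v ≡ side-degree (side v)
  degree-side v = by-side (side v)
    where
      xor-true : ∀ t → xorB true t ≡ not t
      xor-true true  = refl
      xor-true false = refl
      xor-false : ∀ t → xorB false t ≡ t
      xor-false true  = refl
      xor-false false = refl
      by-side : ∀ s → sumFin (a + b) (λ u → indicator (xorB s (side u))) ≡ side-degree s
      by-side true  = trans (sumFin-cong (a + b) (λ u → cong indicator (xor-true (side u)))) (right-count a b)
      by-side false = trans (sumFin-cong (a + b) (λ u → cong indicator (xor-false (side u)))) (left-count a b)

  degree>0 : ∀ v → 0 < deg (K a b) v
  degree>0 v = subst (0 <_) (sym (degree-side v)) (by-side (side v))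
    where by-side : ∀ s → 0 < side-degree s
          by-side true  = b≥1
          by-side false = a≥1

  neighbour-side : ∀ v u → adj (K a b) v u ≡ true → side u ≡ not (side v)
  neighbour-side v u v~u = by-sides (side v) (side u) v~u
    where by-sides : ∀ s t → xorB s t ≡ true → t ≡ not s
          by-sides true  false _ = refl
          by-sides false true  _ = refl

  left-vertex right-vertex : Vertex (K a b)
  left-vertex  = Fin.fromℕ< (≤-trans a≥1 (m≤m+n a b))
  right-vertex = Fin.fromℕ< (subst (_≤ a + b) (+-comm a 1) (+-monoʳ-≤ a b≥1))

  left-side : side left-vertex ≡ true
  left-side = trans (cong (_<ᵇ a) (toℕ-fromℕ< _)) (0<ᵇ a≥1)
    where 0<ᵇ : ∀ {a} → 1 ≤ a → (0 <ᵇ a) ≡ true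
          0<ᵇ (s≤s _) = refl

  right-side : side right-vertex ≡ false
  right-side = trans (cong (_<ᵇ a) (toℕ-fromℕ< _)) (irreflexive a)
    where irreflexive : ∀ a → (a <ᵇ a) ≡ false
          irreflexive zero    = refl
          irreflexive (suc a) = irreflexive a

  degree-by-side : ∀ {v v'} → side v ≡ side v' → deg (K a b) v ≡ deg (K a b) v'
  degree-by-side {v} {v'} same = trans (degree-side v) (trans (cong side-degree same) (sym (degree-side v')))

  left-degree : deg (K a b) left-vertex ≡ b
  left-degree = trans (degree-side left-vertex) (cong side-degree left-side)

  right-degree : deg (K a b) right-vertex ≡ a
  right-degree = trans (degree-side right-vertex) (cong side-degree right-side)

  neighbour-of-left : ∀ u → adj (K a b) left-vertex u ≡ true → side u ≡ side right-vertex
  neighbour-of-left u left~u = trans (neighbour-side left-vertex u left~u) (trans (cong not left-side) (sym right-side))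

  neighbour-of-right : ∀ u → adj (K a b) right-vertex u ≡ true → side u ≡ side left-vertex
  neighbour-of-right u right~u = trans (neighbour-side right-vertex u right~u) (trans (cong not right-side) (sym left-side))

  same-side⇒same-neighbours : ∀ {v v'} → side v ≡ side v' → SameNeighbours (K a b) v v'
  same-side⇒same-neighbours same u = cong (λ s → xorB s (side u)) same

  left-or-right : ∀ v → side v ≡ side left-vertex ⊎ side v ≡ side right-vertex
  left-or-right v = by-side (side v) refl
    where by-side : ∀ s → side v ≡ s → side v ≡ side left-vertex ⊎ side v ≡ side right-vertex
          by-side true  left  = inj₁ (trans left (sym left-side))
          by-side false right = inj₂ (trans right (sym right-side))

  within-two : ∀ v z → WithinTwo (K a b) v z
  within-two v z = by-sides (side v) (side z) refl refl
    where
      by-sides : ∀ s t → side v ≡ s → side z ≡ t → WithinTwo (K a b) v z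
      by-sides true  false v-side z-side = inj₁ (cong₂ xorB v-side z-side)
      by-sides false true  v-side z-side = inj₁ (cong₂ xorB v-side z-side)
      by-sides true  true  v-side z-side =
        inj₂ (right-vertex , cong₂ xorB v-side right-side , cong₂ xorB right-side z-side)
      by-sides false false v-side z-side =
        inj₂ (left-vertex , cong₂ xorB v-side left-side , cong₂ xorB left-side z-side)

module BipartiteGame (a b : ℕ) (a≥1 : 1 ≤ a) (b≥1 : 1 ≤ b) (σ : Position (K a b))
  (p : ℕ) (p>0 : 0 < p) (T : ℕ)
  (periodic : ∀ t → T ≤ t → ∀ v → iterU (K a b) t σ v ≡ iterU (K a b) (t + p) σ v) where

  open Bipartite a b a≥1 b≥1
  open Dynamics (K a b) σ
  open Regime p p>0 T periodic
  open Totals T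

  left-total right-total : ℕ → ℕ
  left-total j  = received-total j left-vertex
  right-total j = received-total j right-vertex

  shift-by-side : ∀ {v w} i j k → side v ≡ side w →
                  received-total j w ≡ received-total i w + k * degree w →
                  received-total j v ≡ received-total i v + k * degree v
  shift-by-side {v} {w} i j k same shifted =
    trans (same-neighbours⇒same-received-total like-w j)
      (trans shifted (cong₂ (λ r d → r + k * d) (sym (same-neighbours⇒same-received-total like-w i))
                                               (sym (degree-by-side same))))
    where like-w : SameNeighbours (K a b) v w
          like-w = same-side⇒same-neighbours same

  module ModerateCase (moderate : Moderate) where

    left-response right-response : ℕ → ℕ
    left-response  = response left-vertex
    right-response = response right-vertex

    left-step : ∀ j → left-total (suc j) ≡ left-response (right-total j)
    left-step j = response-step degree>0 moderate j left-vertex right-vertex λ u left~u →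
      same-neighbours⇒same-received-total (same-side⇒same-neighbours (neighbour-of-left u left~u)) j

    right-step : ∀ j → right-total (suc j) ≡ right-response (left-total j)
    right-step j = response-step degree>0 moderate j right-vertex left-vertex λ u right~u →
      same-neighbours⇒same-received-total (same-side⇒same-neighbours (neighbour-of-right u right~u)) j

    left-response-shift : ∀ z → left-response (z + a) ≡ left-response z + b
    left-response-shift z = trans
      (response-shift left-vertex a a≥1 (λ u left~u → trans (degree-by-side (neighbour-of-left u left~u)) right-degree) z)
      (cong (left-response z +_) left-degree)

    right-response-shift : ∀ z → right-response (z + b) ≡ right-response z + a
    right-response-shift z = trans
      (response-shift right-vertex b b≥1 (λ u right~u → trans (degree-by-side (neighbour-of-right u right~u)) left-degree) z)
      (cong (right-response z +_) right-degree)

    -- Two steps of the game act on the left totals as a lift of a degree-one circle map.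
    round-trip : ℕ → ℕ
    round-trip z = left-response (right-response z)

    round-trip-mono : ∀ {x y} → x ≤ y → round-trip x ≤ round-trip y
    round-trip-mono x≤y = response-mono left-vertex (response-mono right-vertex x≤y)

    round-trip-shift : ∀ z → round-trip (z + b) ≡ round-trip z + b
    round-trip-shift z = trans (cong left-response (right-response-shift z)) (left-response-shift (right-response z))

    open CircleMap round-trip b b≥1 round-trip-mono round-trip-shift

    two-steps : ∀ i j → left-total (i * 2 + j) ≡ iter i (left-total j)
    two-steps zero    j = refl
    two-steps (suc i) j =
      trans (left-step (suc (i * 2 + j)))
            (cong left-response (trans (right-step (i * 2 + j)) (cong right-response (two-steps i j))))

    -- By periodicity of the game every left total lies on a closed orbit.
    left-orbit-closes : ∀ j → ∃ λ D → Closes p D (left-total j)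
    left-orbit-closes j = fired-total (p * 2 + j) left-vertex ∸ fired-total j left-vertex , (begin
        iter p (left-total j)         ≡⟨ two-steps p j ⟨
        left-total (p * 2 + j)        ≡⟨ same-chips⇒received left-vertex (m≤n+m j (p * 2)) same-chips ⟩
        left-total j + D * degree left-vertex  ≡⟨ cong (λ d → left-total j + D * d) left-degree ⟩
        left-total j + D * b          ∎)
      where
        open ≡-Reasoning
        D : ℕ
        D = fired-total (p * 2 + j) left-vertex ∸ fired-total j left-vertex
        same-chips : chips (p * 2 + j + T) left-vertex ≡ chips (j + T) left-vertex
        same-chips = trans (cong (λ q → chips (q + j + T) left-vertex) (*-comm p 2)) (periodic-multiple 2 j left-vertex)

    -- Pigeonhole on the totals of the smaller side gives an orbit closing within min(a, b) rounds.
    short-orbit : ∃ λ x → ∃ λ ℓ → ∃ λ k → 0 < ℓ × ℓ ≤ a ⊓ b × Closes ℓ k x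
    short-orbit with ≤-total a b
    ... | inj₂ b≤a with i , ℓ , k , ℓ>0 , ℓ≤b , recurs ←
          recurrence-mod b b≥1 (λ i → left-total (i * 2)) (λ i≤j → received-total-mono left-vertex (*-monoˡ-≤ 2 i≤j))
        = left-total (i * 2) , ℓ , k , ℓ>0 , subst (ℓ ≤_) (sym (m≥n⇒m⊓n≡n b≤a)) ℓ≤b ,
          trans (sym (two-steps ℓ (i * 2))) (trans (cong left-total (sym (*-distribʳ-+ 2 ℓ i))) recurs)
    short-orbit | inj₁ a≤b with i , ℓ , k , ℓ>0 , ℓ≤a , recurs ←
          recurrence-mod a a≥1 (λ i → right-total (suc (i * 2)))
            (λ i≤j → received-total-mono right-vertex (s≤s (*-monoˡ-≤ 2 i≤j)))
        = left-total (2 + i * 2) , ℓ , k , ℓ>0 , subst (ℓ ≤_) (sym (m≤n⇒m⊓n≡m a≤b)) ℓ≤a , (begin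
            iter ℓ (left-total (2 + i * 2))
              ≡⟨ two-steps ℓ _ ⟨
            left-total (ℓ * 2 + (2 + i * 2))
              ≡⟨ cong left-total (reindex ℓ i) ⟩
            left-total (suc (suc ((ℓ + i) * 2)))
              ≡⟨ left-step (suc ((ℓ + i) * 2)) ⟩
            left-response (right-total (suc ((ℓ + i) * 2)))
              ≡⟨ cong left-response recurs ⟩
            left-response (right-total (suc (i * 2)) + k * a)
              ≡⟨ shift-multiple left-response a b left-response-shift k _ ⟩
            left-response (right-total (suc (i * 2))) + k * b
              ≡⟨ cong (_+ k * b) (left-step (suc (i * 2))) ⟨
            left-total (2 + i * 2) + k * b ∎)
      where open ≡-Reasoning
            reindex : ∀ ℓ i → ℓ * 2 + (2 + i * 2) ≡ suc (suc ((ℓ + i) * 2))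
            reindex = solve-∀

    -- An orbit closing after ℓ rounds with k turns makes the game periodic with period 2ℓ:
    -- after 2ℓ more steps every vertex has received k·deg more chips and fired k more times.
    module ShortOrbit (x ℓ k : ℕ) (closes : Closes ℓ k x) where

      left-shift : ∀ j → left-total (ℓ * 2 + j) ≡ left-total j + k * b
      left-shift j = let D , closes-j = left-orbit-closes j in
        trans (two-steps ℓ j) (orbit-closes ℓ p k D x (left-total j) p>0 closes closes-j)

      right-shift : ∀ j → right-total (ℓ * 2 + suc j) ≡ right-total (suc j) + k * a
      right-shift j = begin
          right-total (ℓ * 2 + suc j)
            ≡⟨ cong right-total (+-suc (ℓ * 2) j) ⟩
          right-total (suc (ℓ * 2 + j))
            ≡⟨ right-step (ℓ * 2 + j) ⟩
          right-response (left-total (ℓ * 2 + j))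
            ≡⟨ cong right-response (left-shift j) ⟩
          right-response (left-total j + k * b)
            ≡⟨ shift-multiple right-response b a right-response-shift k _ ⟩
          right-response (left-total j) + k * a
            ≡⟨ cong (_+ k * a) (right-step j) ⟨
          right-total (suc j) + k * a ∎
        where open ≡-Reasoning

      received-shift : ∀ j v → received-total (ℓ * 2 + suc j) v ≡ received-total (suc j) v + k * degree v
      received-shift j v with left-or-right v
      ... | inj₁ left  = shift-by-side (suc j) (ℓ * 2 + suc j) k left
                           (trans (left-shift (suc j)) (cong (λ d → left-total (suc j) + k * d) (sym left-degree)))
      ... | inj₂ right = shift-by-side (suc j) (ℓ * 2 + suc j) k right
                           (trans (right-shift j) (cong (λ d → right-total (suc j) + k * d) (sym right-degree)))

      fired-shift : ∀ j v → fired-total (ℓ * 2 + suc (suc j)) v ≡ fired-total (suc (suc j)) v + k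
      fired-shift j v = begin
          fired-total (ℓ * 2 + suc (suc j)) v
            ≡⟨ cong (λ i → fired-total i v) (+-suc (ℓ * 2) (suc j)) ⟩
          fired-total (suc (ℓ * 2 + suc j)) v
            ≡⟨ fired-total-formula (ℓ * 2 + suc j) v (degree>0 v) (moderate (ℓ * 2 + suc j) v) ⟩
          ⌊ start v + received-total (ℓ * 2 + suc j) v / degree v ⌋
            ≡⟨ cong (λ r → ⌊ start v + r / degree v ⌋) (received-shift j v) ⟩
          ⌊ start v + (received-total (suc j) v + k * degree v) / degree v ⌋
            ≡⟨ cong (λ y → ⌊ y / degree v ⌋) (+-assoc (start v) _ _) ⟨
          ⌊ start v + received-total (suc j) v + k * degree v / degree v ⌋
            ≡⟨ ⌊/⌋-+* (degree v) (degree>0 v) _ k ⟩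
          ⌊ start v + received-total (suc j) v / degree v ⌋ + k
            ≡⟨ cong (_+ k) (fired-total-formula (suc j) v (degree>0 v) (moderate (suc j) v)) ⟨
          fired-total (suc (suc j)) v + k ∎
        where open ≡-Reasoning

      chips-shift : ∀ j v → chips (suc (suc j) + T + 2 * ℓ) v ≡ chips (suc (suc j) + T) v
      chips-shift j v =
        trans (cong (λ s → chips s v) (reorder ℓ (suc (suc j)) T))
              (received-fired⇒same-chips {suc (suc j)} {ℓ * 2 + suc (suc j)} v k
                 (received-shift (suc j) v) (fired-shift j v))
        where reorder : ∀ ℓ i T → i + T + 2 * ℓ ≡ ℓ * 2 + i + T
              reorder = solve-∀

      periodic-2ℓ : EventuallyPeriodic (K a b) σ (2 * ℓ)
      periodic-2ℓ = 2 + T , λ t 2+T≤t v →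
        subst (λ s → chips s v ≡ chips (s + 2 * ℓ) v) (sym (t≡ t 2+T≤t))
              (sym (chips-shift (t ∸ (2 + T)) v))
        where t≡ : ∀ t → 2 + T ≤ t → t ≡ suc (suc (t ∸ (2 + T))) + T
              t≡ t 2+T≤t = trans (sym (m∸n+n≡m 2+T≤t)) (shuffle (t ∸ (2 + T)) T)
                where shuffle : ∀ j T → j + (2 + T) ≡ suc (suc j) + T
                      shuffle = solve-∀

    moderate⇒short-period : ∃ λ ℓ → 0 < ℓ × ℓ ≤ a ⊓ b × EventuallyPeriodic (K a b) σ (2 * ℓ)
    moderate⇒short-period = let x , ℓ , k , ℓ>0 , ℓ≤ , closes = short-orbit in
      ℓ , ℓ>0 , ℓ≤ , ShortOrbit.periodic-2ℓ x ℓ k closes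

  -- Either some vertex is rich at a time in [T, T + p), and then the game is
  -- eventually constant, or no vertex is ever rich after T and the moderate
  -- analysis applies.
  short-eventual-period : ∃ λ ℓ → 0 < ℓ × ℓ ≤ a ⊓ b × EventuallyPeriodic (K a b) σ (2 * ℓ)
  short-eventual-period with any? (λ i → any? (λ v → 2 * degree v ≤? chips (toℕ i + T) v))
  ... | yes (i , v , rich) =
        1 , s≤s z≤n , ⊓-glb a≥1 b≥1 , rich⇒constant (toℕ i + T) v (m≤n+m T _) rich (within-two v) 2
  ... | no nobody-rich = ModerateCase.moderate⇒short-period moderate
    where
      instance
        p≢0 : NonZero p
        p≢0 = >-nonZero p>0
      moderate : Moderate
      moderate j u = ≰⇒> λ rich → nobody-rich (Fin.fromℕ< (m%n<n j p) , u , subst (2 * degree u ≤_) reduce rich)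
        where
          reduce : chips (j + T) u ≡ chips (toℕ (Fin.fromℕ< (m%n<n j p)) + T) u
          reduce = begin
              chips (j + T) u
                ≡⟨ cong (λ i → chips (i + T) u) (trans (m≡m%n+[m/n]*n j p) (+-comm (j % p) _)) ⟩
              chips (j / p * p + j % p + T) u
                ≡⟨ periodic-multiple (j / p) (j % p) u ⟩
              chips (j % p + T) u
                ≡⟨ cong (λ i → chips (i + T) u) (toℕ-fromℕ< (m%n<n j p)) ⟨
              chips (toℕ (Fin.fromℕ< (m%n<n j p)) + T) u ∎
            where open ≡-Reasoning

corollary3p6 : (a b : ℕ) → 1 ≤ a → 1 ≤ b → (σ : Position (K a b)) → (p : ℕ)
    → IsPeriod (K a b) σ p
    → ((¬ (2 ∣ p)) → p ≤ a ⊓ b) × ((2 ∣ p) → p ≤ 2 * (a ⊓ b))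
corollary3p6 a b a≥1 b≥1 σ p period@(p>0 , (T , periodic) , _)
  with ℓ , ℓ>0 , ℓ≤min , periodic-2ℓ ← BipartiteGame.short-eventual-period a b a≥1 b≥1 σ p p>0 T periodic
  = divisor-of-double-bound p ℓ (a ⊓ b) ℓ>0 ℓ≤min
      (period-divides period (2 * ℓ) (≤-trans ℓ>0 (m≤m+n ℓ _)) periodic-2ℓ)
  where open Periods (K a b) σ
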